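{- Let $n\ge1$ and let $\pi$ be a permutation of $\{0,1,\dots,n-1\}$ consisting of a single cycle. Then the words $u=0\,1\,\cdots\,(n-1)$ and $v=\pi(0)\,\pi(1)\,\cdots\,\pi(n-1)$ over the alphabet $\{0,1,\dots,n-1\}$ are cyclically equalizable.
   Context: Two words $x=x_0\cdots x_{N-1}$, $y$ of length $N$ are cyclically equivalent if $y=x_rx_{r+1}\cdots x_{N-1}x_0\cdots x_{r-1}$ for some integer $r$. Given words $w_1,w_2\in\Sigma^n$ with $w_i=a_{i,0}\cdots a_{i,n-1}$, a simultaneous insertion transforms each $w_i$ into $x_0a_{i,0}x_1a_{i,1}\cdots x_{n-1}a_{i,n-1}x_n$, where the words $x_0,\dots,x_n\in\Sigma^*$ are the same for both $i$. Two words of equal length are cyclically equalizable if some simultaneous insertion transforms them into cyclically equivalent words. -}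

module Defs where

open import Data.Nat using (ℕ; zero; suc)
open import Data.Fin using (Fin)
open import Data.List using (List; []; _∷_; _++_; drop; take; length)
open import Data.Vec using (Vec; []; _∷_; tabulate)
open import Data.Product using (∃; ∃-syntax; _×_)
open import Data.Fin.Permutation using (Permutation′; _⟨$⟩ʳ_)
open import Relation.Binary.PropositionalEquality using (_≡_)

-- Cyclic equivalence: y is a rotation x_r … x_{N-1} x_0 … x_{r-1} of x
-- (same length; rotation amount r ranges over 0 … N, which covers all r mod N).
CyclicallyEquivalent : {A : Set} → List A → List A → Set
CyclicallyEquivalent x y = length x ≡ length y × ∃[ r ] (y ≡ drop r x ++ take r x)

-- Simultaneous insertion: w = a_0 … a_{n-1} becomes x_0 a_0 x_1 a_1 … x_{n-1} a_{n-1} x_n,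
-- where the inserted words are given by  xs = x_0 … x_{n-1}  and the final word  x_n.
insert : {A : Set} {n : ℕ} → Vec (List A) n → List A → Vec A n → List A
insert []       xₙ []       = xₙ
insert (x ∷ xs) xₙ (a ∷ as) = x ++ a ∷ insert xs xₙ as

CyclicallyEqualizable : {A : Set} {n : ℕ} → Vec A n → Vec A n → Set
CyclicallyEqualizable {A} {n} w₁ w₂ =
  ∃[ xs ] ∃[ xₙ ] CyclicallyEquivalent (insert {A} {n} xs xₙ w₁) (insert xs xₙ w₂)

iter : {n : ℕ} → Permutation′ n → ℕ → Fin n → Fin n
iter π zero    i = i
iter π (suc k) i = π ⟨$⟩ʳ iter π k i

SingleCycle : {n : ℕ} → Permutation′ n → Set
SingleCycle {n} π = ∀ (i j : Fin n) → ∃[ k ] (iter π k i ≡ j)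

identityWord : (n : ℕ) → Vec (Fin n) n
identityWord n = tabulate (λ i → i)

permWord : {n : ℕ} → Permutation′ n → Vec (Fin n) n
permWord {n} π = tabulate (λ i → π ⟨$⟩ʳ i)

module Submission where

-- Let c₀ = 0, c_{e+1} = π(c_e), let p be the period of 0 and L = c_{p-1} ⋯ c₁ c₀ the orbit of 0
-- listed backwards. For j ≥ 1 let R_j be L with every entry x < j replaced by π(x). Pad u to
-- 0 R₁ ⋯ Rₙ by putting each letter j of u (0 < j < n) where L has the entry j in R_j. The same
-- insertion puts π(j) there in v, which turns R_j into R_{j+1}; so v becomes π(0) R₂ ⋯ R_{n+1}.
-- Since R₁ = c_{p-1} ⋯ c₁ π(0) and R_{n+1} = 0 c_{p-1} ⋯ c₁, the padded u is (0 c_{p-1} ⋯ c₁) Y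
-- and the padded v is Y (0 c_{p-1} ⋯ c₁), with Y = π(0) R₂ ⋯ Rₙ.

open import Defs
open import Data.Bool using (if_then_else_)
open import Data.Fin as Fin using (Fin; toℕ; fromℕ; fromℕ<)
open import Data.Fin.Patterns using (0F)
open import Data.Fin.Permutation using (Permutation′; _⟨$⟩ʳ_)
open import Data.Fin.Properties
  using (toℕ<n; toℕ-fromℕ; toℕ-fromℕ<; toℕ-inject; toℕ-injective; ¬∀⟶∃¬-smallest)
open import Data.List
  using (List; []; _∷_; _++_; _∷ʳ_; [_]; map; concatMap; mapMaybe; applyUpTo; upTo;
         applyDownFrom; drop; take; length)
open import Data.List.Membership.Propositional using (_∈_)
open import Data.List.Membership.Propositional.Properties using (∈-++⁺ʳ; ∈-map⁺)
open import Data.List.Properties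
  using (mapMaybe-++; map-++; map-∘; map-cong; map-id-local; map-concatMap; concatMap-map;
         concatMap-cong; concatMap-++; ++-assoc; ++-identityʳ; applyUpTo-∷ʳ; map-applyUpTo;
         applyDownFrom-∷ʳ; map-applyDownFrom; length-++-comm; map-injective; ∷-injectiveˡ;
         ∷-injectiveʳ)
open import Data.List.Relation.Binary.Permutation.Propositional.Properties using (∈-resp-↭; ∷↭∷ʳ)
open import Data.List.Relation.Unary.All as All using (All; []; _∷_)
import Data.List.Relation.Unary.All.Properties as All
open import Data.List.Relation.Unary.AllPairs using (_∷_)
open import Data.List.Relation.Unary.Any using (here; there)
open import Data.List.Relation.Unary.Unique.Propositional using (Unique)
open import Data.List.Relation.Unary.Unique.Propositional.Properties using (applyDownFrom⁺₁)
open import Data.Nat using (ℕ; zero; suc; _≥_; _≤_; _<_; z≤n; s≤s; s<s⁻¹; _<?_; _≟_)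
open import Data.Nat.Properties
  using (≤-refl; <-≤-trans; <-trans; n<1+n; n≤1+n; m<n⇒m<1+n; ≤∧≢⇒<; ≮⇒≥; <⇒≢; ≤⇒≯)
open import Data.Product using (∃-syntax; _×_; _,_; proj₂)
open import Data.Sum using (_⊎_; inj₁; inj₂; [_,_]′; isInj₂)
open import Data.Vec as Vec using (Vec; []; _∷_; toList; tabulate)
open import Data.Vec.Properties using (toList-map; tabulate-∘; map-id)
open import Function using (id; _∘_)
open import Function.Bundles using (Injection)
open import Function.Properties.Inverse using (↔⇒↣)
open import Relation.Nullary using (¬_; does; yes; no)
open import Relation.Nullary.Decidable using (dec-true; dec-false; decidable-stable; ¬?)
open import Relation.Unary using (Decidable)
open import Relation.Binary.PropositionalEquality
  using (_≡_; _≢_; refl; sym; trans; cong; cong₂; subst; subst₂; module ≡-Reasoning)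
open ≡-Reasoning

private
  variable
    A B : Set
    k : ℕ

toList-tabulate-toℕ : ∀ k (f : ℕ → A) → toList (tabulate {n = k} (f ∘ toℕ)) ≡ applyUpTo f k
toList-tabulate-toℕ zero    f = refl
toList-tabulate-toℕ (suc k) f = cong (f 0 ∷_) (toList-tabulate-toℕ k (f ∘ suc))

unique-∷ʳ⇒∉ : {xs : List A} {x : A} → Unique (xs ∷ʳ x) → All (_≢ x) xs
unique-∷ʳ⇒∉ {xs = []}    _         = []
unique-∷ʳ⇒∉ {xs = _ ∷ _} (y≢ ∷ u) = proj₂ (All.∷ʳ⁻ y≢) ∷ unique-∷ʳ⇒∉ u

least-witness : {P : ℕ → Set} → Decidable P → P k → ∃[ q ] (P q × (∀ {e} → e < q → ¬ P e))
least-witness {k = k} {P = P} P? Pk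
  with i , ¬¬Pi , below ← ¬∀⟶∃¬-smallest (suc k) (¬_ ∘ P ∘ toℕ) (¬? ∘ P? ∘ toℕ)
                            (λ ¬P → ¬P (fromℕ k) (subst P (sym (toℕ-fromℕ k)) Pk))
  = toℕ i , decidable-stable (P? (toℕ i)) ¬¬Pi
  , λ e<i → subst (¬_ ∘ P) (trans (toℕ-inject _) (toℕ-fromℕ< e<i)) (below (fromℕ< e<i))

++-swap-cyclic : (xs ys : List A) → CyclicallyEquivalent (xs ++ ys) (ys ++ xs)
++-swap-cyclic xs ys =
  length-++-comm xs ys , length xs , sym (cong₂ _++_ (drop-length xs) (take-length xs))
  where
  drop-length : ∀ zs → drop (length zs) (zs ++ ys) ≡ ys
  drop-length []       = refl
  drop-length (_ ∷ zs) = drop-length zs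
  take-length : ∀ zs → take (length zs) (zs ++ ys) ≡ zs
  take-length []       = refl
  take-length (z ∷ zs) = cong (z ∷_) (take-length zs)

-- A template is a word with holes: inj₁ a is a fixed letter and inj₂ b a hole.
holes : List (A ⊎ B) → List B
holes = mapMaybe isInj₂

fill : (B → A) → List (A ⊎ B) → List A
fill g = map [ id , g ]′

insert-∷ : (a : A) (xs : Vec (List A) k) (xₙ : List A) →
  ∃[ ys ] ∃[ yₙ ] (∀ w → insert ys yₙ w ≡ a ∷ insert xs xₙ w)
insert-∷ a []       xₙ = [] , a ∷ xₙ , λ { [] → refl }
insert-∷ a (x ∷ xs) xₙ = (a ∷ x) ∷ xs , xₙ , λ { (_ ∷ _) → refl }

insert-fill : (T : List (A ⊎ B)) (w : Vec B k) → holes T ≡ toList w →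
  ∃[ xs ] ∃[ xₙ ] (∀ g → insert xs xₙ (Vec.map g w) ≡ fill g T)
insert-fill []           []      _  = [] , [] , λ _ → refl
insert-fill (inj₁ a ∷ T) w       eq
  with xs , xₙ , ins ← insert-fill T w eq
  with ys , yₙ , prepend ← insert-∷ a xs xₙ
  = ys , yₙ , λ g → trans (prepend (Vec.map g w)) (cong (a ∷_) (ins g))
insert-fill (inj₂ b ∷ T) (c ∷ w) eq
  with xs , xₙ , ins ← insert-fill T w (∷-injectiveʳ eq)
  = [] ∷ xs , xₙ , λ g → cong₂ _∷_ (cong g (sym (∷-injectiveˡ eq))) (ins g)

fill-equalizable : (T : List (A ⊎ B)) (w : Vec B k) {f g : B → A} → holes T ≡ toList w →
  CyclicallyEquivalent (fill f T) (fill g T) → CyclicallyEqualizable (Vec.map f w) (Vec.map g w)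
fill-equalizable T w {f} {g} eq equiv with xs , xₙ , ins ← insert-fill T w eq =
  xs , xₙ , subst₂ CyclicallyEquivalent (sym (ins f)) (sym (ins g)) equiv

-- For ys = L, rowWord ys j is R_j of the proof idea and row ys j is R_j with the entry j as a hole.
module Rows {n : ℕ} (σ : Fin n → Fin n) where

  letter : ℕ → Fin n → Fin n
  letter j x = if does (toℕ x <? j) then σ x else x

  cell : ℕ → Fin n → Fin n ⊎ Fin n
  cell j x = if does (toℕ x ≟ j) then inj₂ x else inj₁ (letter j x)

  row : List (Fin n) → ℕ → List (Fin n ⊎ Fin n)
  row ys j = map (cell j) ys

  rowWord : List (Fin n) → ℕ → List (Fin n)
  rowWord ys j = map (letter j) ys

  private
    variable
      j : ℕ
      x : Fin n
      ys : List (Fin n)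
      js : List ℕ

  letter-< : toℕ x < j → letter j x ≡ σ x
  letter-< {x} {j} x<j rewrite dec-true (toℕ x <? j) x<j = refl

  letter-≥ : j ≤ toℕ x → letter j x ≡ x
  letter-≥ {j} {x} j≤x rewrite dec-false (toℕ x <? j) (≤⇒≯ j≤x) = refl

  letter-suc : toℕ x ≢ j → letter j x ≡ letter (suc j) x
  letter-suc {x} {j} x≢j with toℕ x <? j
  ... | yes x<j = trans (letter-< x<j) (sym (letter-< (m<n⇒m<1+n x<j)))
  ... | no  x≮j = trans (letter-≥ (≮⇒≥ x≮j)) (sym (letter-≥ (≤∧≢⇒< (≮⇒≥ x≮j) (x≢j ∘ sym))))

  cell-hole : cell (toℕ x) x ≡ inj₂ x
  cell-hole {x} rewrite dec-true (toℕ x ≟ toℕ x) refl = refl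

  cell-fixed : toℕ x ≢ j → cell j x ≡ inj₁ (letter j x)
  cell-fixed {x} {j} x≢j rewrite dec-false (toℕ x ≟ j) x≢j = refl

  fill-cell-id : [ id , id ]′ (cell j x) ≡ letter j x
  fill-cell-id {j} {x} with toℕ x ≟ j
  ... | yes refl = trans (cong [ id , id ]′ (cell-hole {x})) (sym (letter-≥ {x = x} ≤-refl))
  ... | no  x≢j  = cong [ id , id ]′ (cell-fixed x≢j)

  fill-cell-σ : [ id , σ ]′ (cell j x) ≡ letter (suc j) x
  fill-cell-σ {j} {x} with toℕ x ≟ j
  ... | yes refl = trans (cong [ id , σ ]′ (cell-hole {x})) (sym (letter-< {x} (n<1+n (toℕ x))))
  ... | no  x≢j  = trans (cong [ id , σ ]′ (cell-fixed x≢j)) (letter-suc x≢j)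

  fill-row-id : ∀ ys j → fill id (row ys j) ≡ rowWord ys j
  fill-row-id ys j = trans (sym (map-∘ ys)) (map-cong (λ y → fill-cell-id {j} {y}) ys)

  fill-row-σ : ∀ ys j → fill σ (row ys j) ≡ rowWord ys (suc j)
  fill-row-σ ys j = trans (sym (map-∘ ys)) (map-cong (λ y → fill-cell-σ {j} {y}) ys)

  fill-rows-id : ∀ ys js → fill id (concatMap (row ys) js) ≡ concatMap (rowWord ys) js
  fill-rows-id ys js = trans (map-concatMap _ (row ys) js) (concatMap-cong (fill-row-id ys) js)

  fill-rows-σ : ∀ ys js → fill σ (concatMap (row ys) js) ≡ concatMap (rowWord ys) (map suc js)
  fill-rows-σ ys js = begin
    fill σ (concatMap (row ys) js)
      ≡⟨ map-concatMap _ (row ys) js ⟩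
    concatMap (fill σ ∘ row ys) js
      ≡⟨ concatMap-cong (fill-row-σ ys) js ⟩
    concatMap (rowWord ys ∘ suc) js
      ≡⟨ concatMap-map (rowWord ys) suc js ⟨
    concatMap (rowWord ys) (map suc js) ∎

  holes-row-none : All (λ y → toℕ y ≢ j) ys → holes (row ys j) ≡ []
  holes-row-none []              = refl
  holes-row-none (y≢j ∷ ys≢j) rewrite cell-fixed y≢j = holes-row-none ys≢j

  holes-row-unique : Unique ys → x ∈ ys → holes (row ys (toℕ x)) ≡ [ x ]
  holes-row-unique {y ∷ _} (y≢ys ∷ _) (here refl) rewrite cell-hole {y} =
    cong (y ∷_) (holes-row-none (All.map (λ y≢z → y≢z ∘ sym ∘ toℕ-injective) y≢ys))
  holes-row-unique (y≢ys ∷ u) (there x∈ys)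
    rewrite cell-fixed (All.lookup y≢ys x∈ys ∘ toℕ-injective) = holes-row-unique u x∈ys

  holes-row-single : Unique ys → (∀ x → x ∈ ys) → j < n → map toℕ (holes (row ys j)) ≡ [ j ]
  holes-row-single {ys} {j} u complete j<n = begin
    map toℕ (holes (row ys j))        ≡⟨ cong (map toℕ ∘ holes ∘ row ys) (toℕ-fromℕ< j<n) ⟨
    map toℕ (holes (row ys (toℕ x′))) ≡⟨ cong (map toℕ) (holes-row-unique u (complete x′)) ⟩
    [ toℕ x′ ]                        ≡⟨ cong [_] (toℕ-fromℕ< j<n) ⟩
    [ j ]                             ∎
    where x′ = fromℕ< j<n

  holes-rows : Unique ys → (∀ x → x ∈ ys) → All (_< n) js →
    map toℕ (holes (concatMap (row ys) js)) ≡ js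
  holes-rows _ _ [] = refl
  holes-rows {ys} {j ∷ js} u complete (j<n ∷ js<n) = begin
    map toℕ (holes (row ys j ++ concatMap (row ys) js))
      ≡⟨ cong (map toℕ) (mapMaybe-++ isInj₂ (row ys j) _) ⟩
    map toℕ (holes (row ys j) ++ holes (concatMap (row ys) js))
      ≡⟨ map-++ toℕ (holes (row ys j)) _ ⟩
    map toℕ (holes (row ys j)) ++ map toℕ (holes (concatMap (row ys) js))
      ≡⟨ cong₂ _++_ (holes-row-single u complete j<n) (holes-rows u complete js<n) ⟩
    j ∷ js ∎

  holes-row-beyond : n ≤ j → holes (row ys j) ≡ []
  holes-row-beyond {ys = ys} n≤j =
    holes-row-none {ys = ys} (All.universal (λ y → <⇒≢ (<-≤-trans (toℕ<n y) n≤j)) ys)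

  rowWord-beyond : n ≤ j → rowWord ys j ≡ map σ ys
  rowWord-beyond {ys = ys} n≤j = map-cong (λ y → letter-< (<-≤-trans (toℕ<n y) n≤j)) ys

  rowWord-below : All (λ y → j ≤ toℕ y) ys → rowWord ys j ≡ ys
  rowWord-below j≤ys = map-id-local (All.map (λ {y} → letter-≥ {x = y}) j≤ys)

-- rest ∷ʳ 0F is the σ-orbit of 0 listed backwards, the word L of the proof idea.
record CyclicListing {m : ℕ} (σ : Fin (suc m) → Fin (suc m)) : Set where
  field
    rest     : List (Fin (suc m))
    unique   : Unique (rest ∷ʳ 0F)
    complete : ∀ x → x ∈ rest ∷ʳ 0F
    rotates  : map σ (rest ∷ʳ 0F) ≡ 0F ∷ rest

module _ {m : ℕ} {σ : Fin (suc m) → Fin (suc m)} (L : CyclicListing σ) where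
  open CyclicListing L
  open Rows σ

  private
    n = suc m
    listing = rest ∷ʳ 0F
    middle = concatMap (rowWord listing) (applyUpTo (suc ∘ suc) m)

  template : List (Fin n ⊎ Fin n)
  template = inj₂ 0F ∷ concatMap (row listing) (applyUpTo suc n)

  template-holes : map toℕ (holes template) ≡ upTo n
  template-holes = cong (0 ∷_) (begin
    map toℕ (holes (concatMap (row listing) (applyUpTo suc n)))
      ≡⟨ cong (map toℕ ∘ holes ∘ concatMap (row listing)) (applyUpTo-∷ʳ suc m) ⟨
    map toℕ (holes (concatMap (row listing) (applyUpTo suc m ∷ʳ n)))
      ≡⟨ cong (map toℕ ∘ holes) (concatMap-++ (row listing) (applyUpTo suc m) [ n ]) ⟩
    map toℕ (holes (inner ++ row listing n ++ []))
      ≡⟨ cong (map toℕ) (mapMaybe-++ isInj₂ inner _) ⟩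
    map toℕ (holes inner ++ holes (row listing n ++ []))
      ≡⟨ cong (λ h → map toℕ (holes inner ++ h)) last-row ⟩
    map toℕ (holes inner ++ [])
      ≡⟨ cong (map toℕ) (++-identityʳ (holes inner)) ⟩
    map toℕ (holes inner)
      ≡⟨ holes-rows unique complete (All.applyUpTo⁺₁ suc m s≤s) ⟩
    applyUpTo suc m ∎)
    where
    inner = concatMap (row listing) (applyUpTo suc m)
    last-row : holes (row listing n ++ []) ≡ []
    last-row = trans (cong holes (++-identityʳ (row listing n)))
                     (holes-row-beyond {ys = listing} ≤-refl)

  rowWord-first : rowWord listing 1 ≡ rest ∷ʳ σ 0F
  rowWord-first = begin
    rowWord (rest ++ [ 0F ]) 1 ≡⟨ map-++ (letter 1) rest [ 0F ] ⟩
    rowWord rest 1 ++ [ σ 0F ] ≡⟨ cong (_∷ʳ σ 0F) (rowWord-below rest-positive) ⟩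
    rest ∷ʳ σ 0F               ∎
    where
    positive : ∀ {y} → y ≢ 0F → 1 ≤ toℕ y
    positive y≢0 = ≤∧≢⇒< z≤n (y≢0 ∘ toℕ-injective ∘ sym)
    rest-positive : All (λ y → 1 ≤ toℕ y) rest
    rest-positive = All.map positive (unique-∷ʳ⇒∉ unique)

  template-fill-id : fill id template ≡ (0F ∷ rest) ++ σ 0F ∷ middle
  template-fill-id = cong (0F ∷_) (begin
    fill id (concatMap (row listing) (applyUpTo suc n)) ≡⟨ fill-rows-id listing (applyUpTo suc n) ⟩
    rowWord listing 1 ++ middle                         ≡⟨ cong (_++ middle) rowWord-first ⟩
    (rest ∷ʳ σ 0F) ++ middle                            ≡⟨ ++-assoc rest [ σ 0F ] middle ⟩
    rest ++ σ 0F ∷ middle                               ∎)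

  template-fill-σ : fill σ template ≡ (σ 0F ∷ middle) ++ (0F ∷ rest)
  template-fill-σ = cong (σ 0F ∷_) (begin
    fill σ (concatMap (row listing) (applyUpTo suc n))
      ≡⟨ fill-rows-σ listing (applyUpTo suc n) ⟩
    concatMap (rowWord listing) (map suc (applyUpTo suc n))
      ≡⟨ cong (concatMap (rowWord listing)) (map-applyUpTo suc suc n) ⟩
    concatMap (rowWord listing) (applyUpTo (suc ∘ suc) n)
      ≡⟨ cong (concatMap (rowWord listing)) (applyUpTo-∷ʳ (suc ∘ suc) m) ⟨
    concatMap (rowWord listing) (applyUpTo (suc ∘ suc) m ∷ʳ suc n)
      ≡⟨ concatMap-++ (rowWord listing) (applyUpTo (suc ∘ suc) m) [ suc n ] ⟩
    middle ++ rowWord listing (suc n) ++ []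
      ≡⟨ cong (middle ++_) (++-identityʳ _) ⟩
    middle ++ rowWord listing (suc n)
      ≡⟨ cong (middle ++_) (trans (rowWord-beyond (n≤1+n n)) rotates) ⟩
    middle ++ 0F ∷ rest ∎)

  cyclicListing⇒equalizable :
    CyclicallyEqualizable (Vec.map id (tabulate {n = n} id)) (Vec.map σ (tabulate id))
  cyclicListing⇒equalizable = fill-equalizable template (tabulate id)
    (map-injective toℕ-injective (begin
      map toℕ (holes template)           ≡⟨ template-holes ⟩
      upTo n                             ≡⟨ toList-tabulate-toℕ n id ⟨
      toList (tabulate toℕ)              ≡⟨ cong toList (tabulate-∘ toℕ id) ⟩
      toList (Vec.map toℕ (tabulate id)) ≡⟨ toList-map toℕ (tabulate id) ⟩
      map toℕ (toList (tabulate id))     ∎))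
    (subst₂ CyclicallyEquivalent (sym template-fill-id) (sym template-fill-σ)
      (++-swap-cyclic (0F ∷ rest) (σ 0F ∷ middle)))

module _ {n : ℕ} (π : Permutation′ n) where

  π-injective : ∀ {x y} → π ⟨$⟩ʳ x ≡ π ⟨$⟩ʳ y → x ≡ y
  π-injective = Injection.injective (↔⇒↣ π)

  iter-sucʳ : ∀ k x → iter π k (π ⟨$⟩ʳ x) ≡ iter π (suc k) x
  iter-sucʳ zero    x = refl
  iter-sucʳ (suc k) x = cong (π ⟨$⟩ʳ_) (iter-sucʳ k x)

  return-time : SingleCycle π → ∀ x → ∃[ k ] (iter π (suc k) x ≡ x)
  return-time single x with k , returns ← single (π ⟨$⟩ʳ x) x =
    k , trans (sym (iter-sucʳ k x)) returns

module Orbit {n : ℕ} (π : Permutation′ n) (x : Fin n) {q : ℕ}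
  (returns : iter π (suc q) x ≡ x) (minimal : ∀ {e} → e < q → iter π (suc e) x ≢ x) where

  orbit : ℕ → Fin n
  orbit e = iter π e x

  rest : List (Fin n)
  rest = applyDownFrom (orbit ∘ suc) q

  orbit-injective : ∀ {i j} → j < i → i < suc q → orbit i ≢ orbit j
  orbit-injective {suc i} {zero}  _   i<p = minimal (s<s⁻¹ i<p)
  orbit-injective {suc i} {suc j} j<i i<p =
    orbit-injective (s<s⁻¹ j<i) (<-trans (n<1+n i) i<p) ∘ π-injective π

  listing-unique : Unique (rest ∷ʳ x)
  listing-unique =
    subst Unique (sym (applyDownFrom-∷ʳ orbit q)) (applyDownFrom⁺₁ orbit (suc q) orbit-injective)

  listing-rotates : map (π ⟨$⟩ʳ_) (rest ∷ʳ x) ≡ x ∷ rest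
  listing-rotates = begin
    map (π ⟨$⟩ʳ_) (rest ∷ʳ x)                  ≡⟨ cong (map (π ⟨$⟩ʳ_)) (applyDownFrom-∷ʳ orbit q) ⟩
    map (π ⟨$⟩ʳ_) (applyDownFrom orbit (suc q)) ≡⟨ map-applyDownFrom orbit (π ⟨$⟩ʳ_) (suc q) ⟩
    orbit (suc q) ∷ rest                        ≡⟨ cong (_∷ rest) returns ⟩
    x ∷ rest                                    ∎

  orbit-∈-listing : ∀ k → orbit k ∈ rest ∷ʳ x
  orbit-∈-listing zero    = ∈-++⁺ʳ rest (here refl)
  orbit-∈-listing (suc k) = ∈-resp-↭ (∷↭∷ʳ x rest)
    (subst (orbit (suc k) ∈_) listing-rotates (∈-map⁺ (π ⟨$⟩ʳ_) (orbit-∈-listing k)))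

  listing-complete : SingleCycle π → ∀ y → y ∈ rest ∷ʳ x
  listing-complete single y with k , reaches ← single x y =
    subst (_∈ rest ∷ʳ x) reaches (orbit-∈-listing k)

singleCycle⇒cyclicListing : {m : ℕ} (π : Permutation′ (suc m)) → SingleCycle π →
  CyclicListing (π ⟨$⟩ʳ_)
singleCycle⇒cyclicListing π single
  with k , returns-at-k ← return-time π single 0F
  with q , returns , minimal ← least-witness {k = k} (λ e → iter π (suc e) 0F Fin.≟ 0F) returns-at-k
  = let open Orbit π 0F returns minimal in record
      { rest     = rest
      ; unique   = listing-unique
      ; complete = listing-complete single
      ; rotates  = listing-rotates
      }

theorem4 : (n : ℕ) → n ≥ 1 → (π : Permutation′ n) → SingleCycle π →
    CyclicallyEqualizable (identityWord n) (permWord π)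
theorem4 (suc m) _ π single =
  subst₂ CyclicallyEqualizable (map-id (identityWord (suc m))) (sym (tabulate-∘ (π ⟨$⟩ʳ_) id))
    (cyclicListing⇒equalizable (singleCycle⇒cyclicListing π single))
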